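{- Let $G$ be a finite simple graph and let $X$ be an independent set of $G$ with $\ker(G) \subseteq X$. If there is a matching from $N(X)$ into $X$, then $X$ is critical.
   Context: For $A \subseteq V(G)$, $N(A)$ is the set of vertices adjacent to some vertex of $A$; $d(A)=|A|-|N(A)|$; $d_c(G)=\max\{d(A): A \subseteq V(G)\}$; a set $A$ is critical if $d(A)=d_c(G)$; $\ker(G)$ is the intersection of all critical sets of $G$. For disjoint $A,B\subseteq V(G)$, a matching from $A$ into $B$ is a matching in which every edge joins a vertex of $A$ and a vertex of $B$ and every vertex of $A$ is matched. -}

module Defs where

open import Data.Nat using (ℕ)
open import Data.Integer using (ℤ; +_; _-_; _≤_)
open import Data.Fin using (Fin)
open import Data.Fin.Subset using (Subset; _∈_; ∣_∣; inside; outside)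
open import Data.Fin.Subset.Properties using (_∈?_)
open import Data.Fin.Properties using (any?)
open import Data.Vec using (tabulate)
open import Data.Product using (Σ; _×_; ∃)
open import Relation.Nullary using (¬_; Dec; does)
open import Relation.Nullary.Decidable using (_×-dec_)
open import Relation.Binary.PropositionalEquality using (_≡_)
open import Data.Bool using (if_then_else_)

record Graph (n : ℕ) : Set₁ where
  field
    Adj     : Fin n → Fin n → Set
    adj?    : ∀ u v → Dec (Adj u v)
    sym     : ∀ {u v} → Adj u v → Adj v u
    irrefl  : ∀ v → ¬ Adj v v

module _ {n : ℕ} (G : Graph n) where
  open Graph G

  N : Subset n → Subset n
  N A = tabulate λ v →
    if does (any? (λ u → (u ∈? A) ×-dec adj? u v)) then inside else outside

  d : Subset n → ℤ
  d A = + ∣ A ∣ - + ∣ N A ∣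

  -- A is critical iff d(A) = d_c(G) = max_B d(B), i.e. d(A) is maximal
  Critical : Subset n → Set
  Critical A = ∀ B → d B ≤ d A

  InKer : Fin n → Set
  InKer v = ∀ A → Critical A → v ∈ A

  Independent : Subset n → Set
  Independent X = ∀ u v → u ∈ X → v ∈ X → ¬ Adj u v

  MatchingInto : Subset n → Subset n → Set
  MatchingInto A B =
    Σ (Fin n → Fin n) λ f →
      (∀ a → a ∈ A → (f a ∈ B × Adj a (f a))) ×
      (∀ a a′ → a ∈ A → a′ ∈ A → f a ≡ f a′ → a ≡ a′)

-- The kernel of G is itself critical: d is supermodular, so the intersection
-- of two critical sets is critical, and a ⊂-minimal critical set lies in every
-- critical set. Let K = ker(G) ⊆ X. A vertex of N(X) outside N(K) is matched
-- to a vertex of X outside K, so |N(X)| - |N(K)| ≤ |X| - |K|, i.e.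
-- d(K) ≤ d(X), and X is critical because K is.
module Submission where

open import Defs
open import Data.Nat as ℕ using (ℕ; suc; _+_) renaming (_≤_ to _≤ℕ_)
import Data.Nat.Properties as ℕ
open import Data.Integer as ℤ using (ℤ) renaming (_≤_ to _≤ℤ_)
import Data.Integer.Properties as ℤ
open import Data.Integer.Tactic.RingSolver using (solve-∀)
open import Data.Fin using (Fin)
open import Data.Fin.Subset using (Subset; _∈_; _∉_; _⊆_; _⊂_; _∩_; _∪_; _─_; _-_; ∣_∣; inside; outside; ⁅_⁆)
open import Data.Fin.Subset.Properties
open import Data.Fin.Subset.Induction using (⊂-wellFounded)
open import Data.Fin.Properties using (any?)
open import Data.Vec using ([]; _∷_; here; there; lookup)
open import Data.Vec.Properties using (lookup∘tabulate; []=⇒lookup; lookup⇒[]=)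
open import Data.Product using (∃; _×_; _,_; proj₁; proj₂)
open import Data.Sum using (inj₁; inj₂)
open import Data.Bool using (true; false; if_then_else_)
open import Data.Empty using (⊥-elim)
open import Induction.WellFounded using (Acc; acc)
open import Relation.Nullary using (Dec; yes; no; does)
open import Relation.Nullary.Decidable using (_×-dec_; decidable-stable)
open import Relation.Unary using (Decidable)
open import Relation.Binary.PropositionalEquality

x∈p─q⇒x∉q : ∀ {n} {x : Fin n} (p q : Subset n) → x ∈ p ─ q → x ∉ q
x∈p─q⇒x∉q (_ ∷ p) (true ∷ q) ()         here
x∈p─q⇒x∉q (_ ∷ p) (_ ∷ q)   (there x∈) (there x∈q) = x∈p─q⇒x∉q p q x∈ x∈q

∣p∩q∣+∣p∪q∣≡∣p∣+∣q∣ : ∀ {n} (p q : Subset n) → ∣ p ∩ q ∣ + ∣ p ∪ q ∣ ≡ ∣ p ∣ + ∣ q ∣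
∣p∩q∣+∣p∪q∣≡∣p∣+∣q∣ []          []          = refl
∣p∩q∣+∣p∪q∣≡∣p∣+∣q∣ (true ∷ p)  (true ∷ q)  =
  cong suc (trans (ℕ.+-suc _ _) (trans (cong suc (∣p∩q∣+∣p∪q∣≡∣p∣+∣q∣ p q)) (sym (ℕ.+-suc _ _))))
∣p∩q∣+∣p∪q∣≡∣p∣+∣q∣ (true ∷ p)  (false ∷ q) =
  trans (ℕ.+-suc _ _) (cong suc (∣p∩q∣+∣p∪q∣≡∣p∣+∣q∣ p q))
∣p∩q∣+∣p∪q∣≡∣p∣+∣q∣ (false ∷ p) (true ∷ q)  =
  trans (ℕ.+-suc _ _) (trans (cong suc (∣p∩q∣+∣p∪q∣≡∣p∣+∣q∣ p q)) (sym (ℕ.+-suc _ _)))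
∣p∩q∣+∣p∪q∣≡∣p∣+∣q∣ (false ∷ p) (false ∷ q) = ∣p∩q∣+∣p∪q∣≡∣p∣+∣q∣ p q

q⊆p⇒∣p∣≡∣q∣+∣p─q∣ : ∀ {n} (p q : Subset n) → q ⊆ p → ∣ p ∣ ≡ ∣ q ∣ + ∣ p ─ q ∣
q⊆p⇒∣p∣≡∣q∣+∣p─q∣ []          []          _   = refl
q⊆p⇒∣p∣≡∣q∣+∣p─q∣ (true ∷ p)  (true ∷ q)  q⊆p = cong suc (q⊆p⇒∣p∣≡∣q∣+∣p─q∣ p q (drop-∷-⊆ q⊆p))
q⊆p⇒∣p∣≡∣q∣+∣p─q∣ (true ∷ p)  (false ∷ q) q⊆p =
  trans (cong suc (q⊆p⇒∣p∣≡∣q∣+∣p─q∣ p q (drop-∷-⊆ q⊆p))) (sym (ℕ.+-suc _ _))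
q⊆p⇒∣p∣≡∣q∣+∣p─q∣ (false ∷ p) (true ∷ q)  q⊆p with () ← q⊆p here
q⊆p⇒∣p∣≡∣q∣+∣p─q∣ (false ∷ p) (false ∷ q) q⊆p = q⊆p⇒∣p∣≡∣q∣+∣p─q∣ p q (drop-∷-⊆ q⊆p)

x∈p⇒∣p∣≡1+∣p-x∣ : ∀ {n} {x : Fin n} (p : Subset n) → x ∈ p → ∣ p ∣ ≡ suc ∣ p - x ∣
x∈p⇒∣p∣≡1+∣p-x∣ {x = x} p x∈p =
  trans (q⊆p⇒∣p∣≡∣q∣+∣p─q∣ p ⁅ x ⁆ ⁅x⁆⊆p) (cong (_+ ∣ p - x ∣) (∣⁅x⁆∣≡1 x))
  where
  ⁅x⁆⊆p : ⁅ x ⁆ ⊆ p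
  ⁅x⁆⊆p y∈⁅x⁆ = subst (_∈ p) (sym (x∈⁅y⁆⇒x≡y x y∈⁅x⁆)) x∈p

injection⇒∣p∣≤∣q∣ : ∀ {m n} (f : Fin m → Fin n) (p : Subset m) (q : Subset n) →
  (∀ {x} → x ∈ p → f x ∈ q) →
  (∀ {x y} → x ∈ p → y ∈ p → f x ≡ f y → x ≡ y) →
  ∣ p ∣ ≤ℕ ∣ q ∣
injection⇒∣p∣≤∣q∣ {m} f p q = go p (⊂-wellFounded p) q
  where
  go : ∀ p → Acc _⊂_ p → ∀ q → (∀ {x} → x ∈ p → f x ∈ q) →
       (∀ {x y} → x ∈ p → y ∈ p → f x ≡ f y → x ≡ y) → ∣ p ∣ ≤ℕ ∣ q ∣
  go p (acc rec) q into inj with nonempty? p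
  ... | no ¬ne = subst (_≤ℕ ∣ q ∣) (sym (trans (cong ∣_∣ (Empty-unique ¬ne)) (∣⊥∣≡0 m))) ℕ.z≤n
  ... | yes (x , x∈p) = begin
    ∣ p ∣              ≡⟨ x∈p⇒∣p∣≡1+∣p-x∣ p x∈p ⟩
    suc ∣ p - x ∣      ≤⟨ ℕ.s≤s (go (p - x) (rec (x∈p⇒p-x⊂p x∈p)) (q - f x) into′ inj′) ⟩
    suc ∣ q - f x ∣    ≡⟨ x∈p⇒∣p∣≡1+∣p-x∣ q (into x∈p) ⟨
    ∣ q ∣              ∎
    where
    open ℕ.≤-Reasoning
    y∈p-x⇒y∈p : ∀ {y} → y ∈ p - x → y ∈ p
    y∈p-x⇒y∈p = p─q⊆p p ⁅ x ⁆
    into′ : ∀ {y} → y ∈ p - x → f y ∈ q - f x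
    into′ y∈ = x∈p∧x≢y⇒x∈p-y (into (y∈p-x⇒y∈p y∈)) λ fy≡fx →
      x∈p─q⇒x∉q p ⁅ x ⁆ y∈
        (subst (_∈ ⁅ x ⁆) (sym (inj (y∈p-x⇒y∈p y∈) x∈p fy≡fx)) (x∈⁅x⁆ x))
    inj′ : ∀ {y z} → y ∈ p - x → z ∈ p - x → f y ≡ f z → y ≡ z
    inj′ y∈ z∈ = inj (y∈p-x⇒y∈p y∈) (y∈p-x⇒y∈p z∈)

argmax : ∀ n (g : Subset n → ℤ) → ∃ λ M → ∀ B → g B ≤ℤ g M
argmax ℕ.zero g = [] , λ { [] → ℤ.≤-refl }
argmax (suc n) g with argmax n (λ B → g (outside ∷ B)) | argmax n (λ B → g (inside ∷ B))
... | M₀ , max₀ | M₁ , max₁ with g (outside ∷ M₀) ℤ.≤? g (inside ∷ M₁)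
... | yes ≤₁ = inside ∷ M₁ , λ { (false ∷ B) → ℤ.≤-trans (max₀ B) ≤₁ ; (true ∷ B) → max₁ B }
... | no ≰₁ = outside ∷ M₀ , λ { (false ∷ B) → max₀ B
                               ; (true ∷ B) → ℤ.≤-trans (max₁ B) (ℤ.<⇒≤ (ℤ.≰⇒> ≰₁)) }

[a-b]+[c-e]≡[a+c]-[b+e] : ∀ a b c e →
  (ℤ.+ a ℤ.- ℤ.+ b) ℤ.+ (ℤ.+ c ℤ.- ℤ.+ e) ≡ ℤ.+ (a + c) ℤ.- ℤ.+ (b + e)
[a-b]+[c-e]≡[a+c]-[b+e] a b c e =
  trans (regroup (ℤ.+ a) (ℤ.+ b) (ℤ.+ c) (ℤ.+ e)) (sym (cong₂ ℤ._-_ (ℤ.pos-+ a c) (ℤ.pos-+ b e)))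
  where
  regroup : ∀ x y z w → (x ℤ.- y) ℤ.+ (z ℤ.- w) ≡ (x ℤ.+ z) ℤ.- (y ℤ.+ w)
  regroup = solve-∀

+-cancelˡ-≤ : ∀ k {i j} → k ℤ.+ i ≤ℤ k ℤ.+ j → i ≤ℤ j
+-cancelˡ-≤ k {i} {j} k+i≤k+j =
  subst₂ _≤ℤ_ (-k+[k+x]≡x k i) (-k+[k+x]≡x k j) (ℤ.+-monoʳ-≤ (ℤ.- k) k+i≤k+j)
  where
  -k+[k+x]≡x : ∀ k x → ℤ.- k ℤ.+ (k ℤ.+ x) ≡ x
  -k+[k+x]≡x = solve-∀

module _ {n : ℕ} (G : Graph n) where
  open Graph G using (Adj; adj?)

  private
    Adjacent-from : Subset n → Fin n → Set
    Adjacent-from A v = ∃ λ u → u ∈ A × Adj u v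

    adjacent-from? : ∀ A v → Dec (Adjacent-from A v)
    adjacent-from? A v = any? (λ u → (u ∈? A) ×-dec adj? u v)

    lookup-N : ∀ A v →
      lookup (N G A) v ≡ (if does (adjacent-from? A v) then inside else outside)
    lookup-N A v = lookup∘tabulate _ v

  ∈N⁺ : ∀ {A u v} → u ∈ A → Adj u v → v ∈ N G A
  ∈N⁺ {A} {u} {v} u∈A u~v =
    lookup⇒[]= v (N G A) (trans (lookup-N A v) (chosen (adjacent-from? A v)))
    where
    chosen : (D : Dec (Adjacent-from A v)) → (if does D then inside else outside) ≡ inside
    chosen (yes _) = refl
    chosen (no ∄) = ⊥-elim (∄ (u , u∈A , u~v))

  ∈N⁻ : ∀ {A v} → v ∈ N G A → Adjacent-from A v
  ∈N⁻ {A} {v} v∈NA =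
    chosen (adjacent-from? A v) (trans (sym (lookup-N A v)) ([]=⇒lookup v∈NA))
    where
    chosen : (D : Dec (Adjacent-from A v)) → (if does D then inside else outside) ≡ inside →
             Adjacent-from A v
    chosen (yes adj) _ = adj
    chosen (no _) ()

  N-mono : ∀ {A B} → A ⊆ B → N G A ⊆ N G B
  N-mono A⊆B v∈NA with u , u∈A , u~v ← ∈N⁻ v∈NA = ∈N⁺ (A⊆B u∈A) u~v

  N-∩ : ∀ A B → N G (A ∩ B) ⊆ N G A ∩ N G B
  N-∩ A B v∈N = x∈p∩q⁺ (N-mono (p∩q⊆p A B) v∈N , N-mono (p∩q⊆q A B) v∈N)

  N-∪ : ∀ A B → N G (A ∪ B) ⊆ N G A ∪ N G B
  N-∪ A B v∈N with u , u∈A∪B , u~v ← ∈N⁻ v∈N with x∈p∪q⁻ A B u∈A∪B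
  ... | inj₁ u∈A = x∈p∪q⁺ (inj₁ (∈N⁺ u∈A u~v))
  ... | inj₂ u∈B = x∈p∪q⁺ (inj₂ (∈N⁺ u∈B u~v))

  ∣N[A∩B]∣+∣N[A∪B]∣≤∣NA∣+∣NB∣ : ∀ A B →
    ∣ N G (A ∩ B) ∣ + ∣ N G (A ∪ B) ∣ ≤ℕ ∣ N G A ∣ + ∣ N G B ∣
  ∣N[A∩B]∣+∣N[A∪B]∣≤∣NA∣+∣NB∣ A B = begin
    ∣ N G (A ∩ B) ∣ + ∣ N G (A ∪ B) ∣
      ≤⟨ ℕ.+-mono-≤ (p⊆q⇒∣p∣≤∣q∣ (N-∩ A B)) (p⊆q⇒∣p∣≤∣q∣ (N-∪ A B)) ⟩
    ∣ N G A ∩ N G B ∣ + ∣ N G A ∪ N G B ∣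
      ≡⟨ ∣p∩q∣+∣p∪q∣≡∣p∣+∣q∣ (N G A) (N G B) ⟩
    ∣ N G A ∣ + ∣ N G B ∣ ∎
    where open ℕ.≤-Reasoning

  d-supermodular : ∀ A B → d G A ℤ.+ d G B ≤ℤ d G (A ∩ B) ℤ.+ d G (A ∪ B)
  d-supermodular A B = begin
    d G A ℤ.+ d G B
      ≡⟨ [a-b]+[c-e]≡[a+c]-[b+e] (∣ A ∣) (∣ N G A ∣) (∣ B ∣) (∣ N G B ∣) ⟩
    ℤ.+ (∣ A ∣ + ∣ B ∣) ℤ.- ℤ.+ (∣ N G A ∣ + ∣ N G B ∣)
      ≡⟨ cong (λ k → ℤ.+ k ℤ.- ℤ.+ (∣ N G A ∣ + ∣ N G B ∣)) (∣p∩q∣+∣p∪q∣≡∣p∣+∣q∣ A B) ⟨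
    ℤ.+ (∣ A ∩ B ∣ + ∣ A ∪ B ∣) ℤ.- ℤ.+ (∣ N G A ∣ + ∣ N G B ∣)
      ≤⟨ ℤ.+-monoʳ-≤ (ℤ.+ (∣ A ∩ B ∣ + ∣ A ∪ B ∣))
           (ℤ.neg-mono-≤ (ℤ.+≤+ (∣N[A∩B]∣+∣N[A∪B]∣≤∣NA∣+∣NB∣ A B))) ⟩
    ℤ.+ (∣ A ∩ B ∣ + ∣ A ∪ B ∣) ℤ.- ℤ.+ (∣ N G (A ∩ B) ∣ + ∣ N G (A ∪ B) ∣)
      ≡⟨ [a-b]+[c-e]≡[a+c]-[b+e] (∣ A ∩ B ∣) (∣ N G (A ∩ B) ∣) (∣ A ∪ B ∣) (∣ N G (A ∪ B) ∣) ⟨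
    d G (A ∩ B) ℤ.+ d G (A ∪ B) ∎
    where open ℤ.≤-Reasoning

  critical-∩ : ∀ {A B} → Critical G A → Critical G B → Critical G (A ∩ B)
  critical-∩ {A} {B} A-crit B-crit C = ℤ.≤-trans (B-crit C) (+-cancelˡ-≤ (d G A) (begin
    d G A ℤ.+ d G B               ≤⟨ d-supermodular A B ⟩
    d G (A ∩ B) ℤ.+ d G (A ∪ B)   ≤⟨ ℤ.+-monoʳ-≤ (d G (A ∩ B)) (A-crit (A ∪ B)) ⟩
    d G (A ∩ B) ℤ.+ d G A         ≡⟨ ℤ.+-comm (d G (A ∩ B)) (d G A) ⟩
    d G A ℤ.+ d G (A ∩ B)         ∎))
    where open ℤ.≤-Reasoning

  critical? : Decidable (Critical G)
  critical? A with anySubset? (λ B → d G A ℤ.<? d G B)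
  ... | yes (B , A<B) = no λ A-crit → ℤ.<⇒≱ A<B (A-crit B)
  ... | no ∄B         = yes λ B → ℤ.≮⇒≥ λ A<B → ∄B (B , A<B)

  IsKernel : Subset n → Set
  IsKernel K = Critical G K × (∀ A → Critical G A → K ⊆ A)

  critical⇒kernel : ∀ A → Acc _⊂_ A → Critical G A → ∃ IsKernel
  critical⇒kernel A (acc rec) A-crit
    with anySubset? (λ B → critical? B ×-dec (A ∩ B) ⊂? A)
  ... | yes (B , B-crit , A∩B⊂A) = critical⇒kernel (A ∩ B) (rec A∩B⊂A) (critical-∩ A-crit B-crit)
  ... | no ∄B = A , A-crit , λ B B-crit {x} x∈A → decidable-stable (x ∈? B) λ x∉B →
    ∄B (B , B-crit , p∩q⊆p A B , x , x∈A , λ x∈A∩B → x∉B (proj₂ (x∈p∩q⁻ A B x∈A∩B)))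

  kernel-exists : ∃ IsKernel
  kernel-exists with M , M-crit ← argmax n (d G) = critical⇒kernel M (⊂-wellFounded M) M-crit

  d-mono-⊆ : ∀ {K X} → K ⊆ X → ∣ N G X ─ N G K ∣ ≤ℕ ∣ X ─ K ∣ → d G K ≤ℤ d G X
  d-mono-⊆ {K} {X} K⊆X s≤t = begin
    d G K                                 ≡⟨ ℤ.+-identityʳ (d G K) ⟨
    d G K ℤ.+ ℤ.0ℤ                        ≡⟨ cong (ℤ._+_ (d G K)) (ℤ.+-inverseʳ (ℤ.+ s)) ⟨
    d G K ℤ.+ (ℤ.+ s ℤ.- ℤ.+ s)           ≤⟨ ℤ.+-monoʳ-≤ (d G K) (ℤ.+-monoˡ-≤ (ℤ.- ℤ.+ s) (ℤ.+≤+ s≤t)) ⟩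
    d G K ℤ.+ (ℤ.+ t ℤ.- ℤ.+ s)           ≡⟨ [a-b]+[c-e]≡[a+c]-[b+e] (∣ K ∣) (∣ N G K ∣) t s ⟩
    ℤ.+ (∣ K ∣ + t) ℤ.- ℤ.+ (∣ N G K ∣ + s) ≡⟨ cong₂ (λ x y → ℤ.+ x ℤ.- ℤ.+ y) (q⊆p⇒∣p∣≡∣q∣+∣p─q∣ X K K⊆X)
                                                (q⊆p⇒∣p∣≡∣q∣+∣p─q∣ (N G X) (N G K) (N-mono K⊆X)) ⟨
    d G X                                 ∎
    where
    open ℤ.≤-Reasoning
    s = ∣ N G X ─ N G K ∣
    t = ∣ X ─ K ∣

  matching-avoids : ∀ {A B} K → MatchingInto G A B → MatchingInto G (A ─ N G K) (B ─ K)
  matching-avoids {A} {B} K (f , f-into , f-inj) = f , into , inj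
    where
    into : ∀ a → a ∈ A ─ N G K → f a ∈ B ─ K × Adj a (f a)
    into a a∈ with fa∈B , a~fa ← f-into a (p─q⊆p A (N G K) a∈) =
      x∈p∧x∉q⇒x∈p─q fa∈B (λ fa∈K → x∈p─q⇒x∉q A (N G K) a∈ (∈N⁺ fa∈K (Graph.sym G a~fa))) , a~fa
    inj : ∀ a a′ → a ∈ A ─ N G K → a′ ∈ A ─ N G K → f a ≡ f a′ → a ≡ a′
    inj a a′ a∈ a′∈ = f-inj a a′ (p─q⊆p A (N G K) a∈) (p─q⊆p A (N G K) a′∈)

  matching⇒∣A∣≤∣B∣ : ∀ {A B} → MatchingInto G A B → ∣ A ∣ ≤ℕ ∣ B ∣
  matching⇒∣A∣≤∣B∣ {A} {B} (f , f-into , f-inj) =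
    injection⇒∣p∣≤∣q∣ f A B (λ a∈A → proj₁ (f-into _ a∈A)) (f-inj _ _)

theorem2p15 : ∀ {n : ℕ} (G : Graph n) (X : Subset n) →
    Independent G X →
    (∀ v → InKer G v → v ∈ X) →
    MatchingInto G (N G X) X →
    Critical G X
theorem2p15 G X _ ker⊆X matching B =
  let K , K-crit , K⊆critical = kernel-exists G
      K⊆X : K ⊆ X
      K⊆X v∈K = ker⊆X _ λ A A-crit → K⊆critical A A-crit v∈K
  in ℤ.≤-trans (K-crit B)
       (d-mono-⊆ G K⊆X (matching⇒∣A∣≤∣B∣ G (matching-avoids G K matching)))
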